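{- Let $\alpha$ be a weak composition and let $i\in\{1,\ldots,\ell(\alpha)\}$ with $\alpha_i=0$. Let $\gamma$ be a weak composition such that $\tilde{s}_i\alpha\trianglelefteq\gamma\trianglelefteq\operatorname{qshift}(\tilde{s}_i\alpha)$ and $\tilde{\theta}_i x^\gamma\neq 0$. Then every weak composition $\beta$ with $\beta_j=\gamma_j$ for $j\notin\{i,i+1\}$, $0\le\beta_i\le\gamma_i-1$, and $\beta_{i+1}=\gamma_i-\beta_i$ satisfies $\alpha\trianglelefteq\beta\trianglelefteq\operatorname{qshift}(\alpha)$.
   Context: A weak composition is a finite sequence $\alpha=(\alpha_1,\ldots,\alpha_n)$ of nonnegative integers; $\ell(\alpha)=n$ is its length; $x^\alpha=x_1^{\alpha_1}\cdots x_n^{\alpha_n}$. Weak compositions are padded with trailing zeros whenever needed so that all vectors compared have a common length. Dominance order: $\beta\trianglelefteq\gamma$ iff $\beta_1+\cdots+\beta_j\le\gamma_1+\cdots+\gamma_j$ for all $j$. Quasisymmetric action: $\tilde{s}_i(\alpha)$ exchanges the entries in positions $i,i+1$ if $\alpha_i=0$ or $\alpha_{i+1}=0$, and fixes $\alpha$ otherwise. Operators: for a monomial $x^\beta$ define $\tilde{\pi}_i(x^\beta)=\dfrac{x_i x^\beta-x_{i+1}x^{\tilde{s}_i(\beta)}}{x_i-x_{i+1}}$, extended linearly, and $\tilde{\theta}_i=\tilde{\pi}_i-1$. Explicitly, $\tilde{\theta}_i x^\alpha=0$ if $\alpha_i=\alpha_{i+1}=0$ or $\alpha_i,\alpha_{i+1}>0$;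 $\tilde{\theta}_ix^\alpha=\sum_{j=1}^{\alpha_i}x^{(\alpha_1,\ldots,\alpha_i-j,j,\ldots,\alpha_n)}$ if $\alpha_i>0=\alpha_{i+1}$; and $\tilde{\theta}_ix^\alpha=-\sum_{j=0}^{\alpha_{i+1}-1}x^{(\alpha_1,\ldots,j,\alpha_{i+1}-j,\ldots,\alpha_n)}$ if $\alpha_i=0<\alpha_{i+1}$ (the displayed entries are in positions $i,i+1$). Fundamental shift: for $v=(v_1,\ldots,v_n)$ with nonnegative integer entries, let $S=\{i_1<\cdots<i_k\}$ be the positions of nonzero entries. Then $\operatorname{qshift}(v)=(w_1,\ldots,w_n)$ where: (1) for $j\in S$, $w_j=v_j$ if $j=1$ or $j-1\in S$, and $w_j=1$ otherwise; (2) if $i_j\in S$, $j<k$, $i_j+1\notin S$, then $w_{i_j+1}=v_{i_{j+1}}-1$; (3) if $1\notin S$ (and $S\ne\emptyset$), $w_1=v_{i_1}-1$; (4) all other $w_j=0$. Example: $\operatorname{qshift}(0,0,3,0,1,4,0,5)=(2,0,1,0,1,4,4,1)$. -}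

module Defs where

open import Data.Nat using (ℕ; zero; suc; _+_; _∸_; _≤_; _⊔_; pred)
open import Data.Nat.Properties using (_≟_)
open import Data.Integer using (ℤ; +_; -_) renaming (_+_ to _+ℤ_)
open import Data.List using (List; []; _∷_; map; length; upTo; drop; concatMap)
open import Data.Maybe using (Maybe; just; nothing; maybe)
open import Data.Bool using (Bool; true; false; if_then_else_; _∧_)
open import Data.Product using (_×_; _,_)
open import Relation.Nullary.Decidable using (⌊_⌋)
open import Relation.Binary.PropositionalEquality using (_≡_)

-- Weak compositions are lists of naturals; positions are 0-INDEXED here
-- (Agda position k corresponds to the paper's position k+1).
-- Entries beyond the length are read as 0 (trailing-zero padding).
get : List ℕ → ℕ → ℕ
get []       _       = 0
get (x ∷ xs) zero    = x
get (x ∷ xs) (suc k) = get xs k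

isZero : ℕ → Bool
isZero zero    = true
isZero (suc _) = false

psum : List ℕ → ℕ → ℕ
psum v zero    = 0
psum v (suc j) = psum v j + get v j

_⊴_ : List ℕ → List ℕ → Set
β ⊴ γ = ∀ j → psum β j ≤ psum γ j

sTilde : ℕ → List ℕ → List ℕ
sTilde i v = map f (upTo (length v ⊔ suc (suc i)))
  where
  a = get v i
  b = get v (suc i)
  swapOK : Bool
  swapOK = isZero a Data.Bool.∨ isZero b
  f : ℕ → ℕ
  f j = if swapOK
        then (if ⌊ j ≟ i ⌋ then b else if ⌊ j ≟ suc i ⌋ then a else get v j)
        else get v j

firstNZ : List ℕ → Maybe ℕ
firstNZ []            = nothing
firstNZ (zero ∷ xs)   = firstNZ xs
firstNZ (suc k ∷ xs)  = just (suc k)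

qshiftAt : List ℕ → ℕ → ℕ
qshiftAt v zero with get v 0
... | suc k = suc k
... | zero  = maybe pred 0 (firstNZ v)                -- rule (3) (or 0 if S = ∅)
qshiftAt v (suc j) with get v (suc j) | get v j
... | suc x | suc _ = suc x
... | suc x | zero  = 1
... | zero  | suc _ = maybe pred 0 (firstNZ (drop (suc j) v))  -- rule (2) (0 if no next)
... | zero  | zero  = 0

qshift : List ℕ → List ℕ
qshift v = map (qshiftAt v) (upTo (length v))

setPair : List ℕ → ℕ → ℕ → ℕ → List ℕ
setPair v i p q = map f (upTo (length v ⊔ suc (suc i)))
  where
  f : ℕ → ℕ
  f j = if ⌊ j ≟ i ⌋ then p else if ⌊ j ≟ suc i ⌋ then q else get v j

-- polynomials as formal finite sums of (coefficient, exponent) terms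
Poly : Set
Poly = List (ℤ × List ℕ)

eqPad : List ℕ → List ℕ → Bool
eqPad []       []       = true
eqPad []       (y ∷ ys) = isZero y ∧ eqPad [] ys
eqPad (x ∷ xs) []       = isZero x ∧ eqPad xs []
eqPad (x ∷ xs) (y ∷ ys) = ⌊ x ≟ y ⌋ ∧ eqPad xs ys

coeff : Poly → List ℕ → ℤ
coeff []             δ = + 0
coeff ((c , a) ∷ ps) δ = (if eqPad a δ then c else + 0) +ℤ coeff ps δ

IsZeroPoly : Poly → Set
IsZeroPoly P = ∀ δ → coeff P δ ≡ + 0

-- θ̃_i x^γ  (i 0-indexed), via the explicit formula
thetaTilde : ℕ → List ℕ → Poly
thetaTilde i γ with get γ i | get γ (suc i)
... | suc a | zero  = map (λ j → (+ 1 , setPair γ i (suc a ∸ suc j) (suc j))) (upTo (suc a))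
... | zero  | suc b = map (λ j → (- (+ 1) , setPair γ i j (suc b ∸ j))) (upTo (suc b))
... | _     | _     = []

-- Write s = s̃ᵢα; as αᵢ = 0, s moves αᵢ₊₁ into slot i (slots are 0-indexed, as in Defs).
-- Passing from s to α, or from γ to β, only redistributes mass between slots i and
-- i+1, so no partial sum changes except psum _ (i+1), and there
-- psum α (i+1) = psum s i ≤ psum γ i ≤ psum β (i+1); hence α ⊴ β.
-- Since γᵢ > 0, θ̃ᵢxᵞ ≠ 0 forces γᵢ₊₁ = 0.  The partial sums of qshift s and qshift α
-- agree except at i+1 and i+2.  At i+1 qshift s is ahead by at most one, and β lies
-- at least one below γ.  At i+2 qshift α has caught up (its entry in slot i+1 is 1
-- when αᵢ₊₁ > 0), while psum β (i+2) = psum γ (i+1).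

module Submission where

open import Defs
open import Data.Bool using (if_then_else_)
open import Data.List using (List; []; _∷_; length; map; applyUpTo; upTo; drop)
open import Data.List.Properties using (length-map; length-upTo; drop-all)
open import Data.Maybe using (just; maybe)
open import Data.Nat using (ℕ; zero; suc; _<_; _≤_; _∸_; _+_; _⊔_; z≤n; s≤s; pred; _≤′_; ≤′-refl; ≤′-step)
open import Data.Nat.Properties
open import Data.Product using (_×_; _,_)
open import Data.Sum using (_⊎_; inj₁; inj₂; [_,_]′)
open import Function using (_∘_; id)
open import Relation.Nullary using (¬_; Dec; yes; no; contradiction)
open import Relation.Nullary.Decidable using (⌊_⌋)
open import Relation.Binary.PropositionalEquality

if-yes : ∀ {P : Set} {A : Set} {x y : A} (d : Dec P) → P → (if ⌊ d ⌋ then x else y) ≡ x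
if-yes (yes _) _ = refl
if-yes (no ¬p) p = contradiction p ¬p

if-no : ∀ {P : Set} {A : Set} {x y : A} (d : Dec P) → ¬ P → (if ⌊ d ⌋ then x else y) ≡ y
if-no (yes p) ¬p = contradiction p ¬p
if-no (no _)  _  = refl

get-≥length : ∀ v {t} → length v ≤ t → get v t ≡ 0
get-≥length []      _         = refl
get-≥length (x ∷ v) (s≤s len≤t) = get-≥length v len≤t

get-map-applyUpTo : ∀ (f g : ℕ → ℕ) {n t} → t < n → get (map f (applyUpTo g n)) t ≡ f (g t)
get-map-applyUpTo f g {suc n} {zero}  _         = refl
get-map-applyUpTo f g {suc n} {suc t} (s≤s t<n) = get-map-applyUpTo f (g ∘ suc) t<n

get-map-upTo : ∀ (f : ℕ → ℕ) n t → (n ≤ t → f t ≡ 0) → get (map f (upTo n)) t ≡ f t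
get-map-upTo f n t f-vanishes with t <? n
... | yes t<n = get-map-applyUpTo f id t<n
... | no  t≮n = begin
  get (map f (upTo n)) t ≡⟨ get-≥length (map f (upTo n)) len≤t ⟩
  0                      ≡⟨ sym (f-vanishes (≮⇒≥ t≮n)) ⟩
  f t                    ∎
  where
  open ≡-Reasoning
  len≤t : length (map f (upTo n)) ≤ t
  len≤t = ≤-trans (≤-reflexive (trans (length-map f (upTo n)) (length-upTo n))) (≮⇒≥ t≮n)

infix 4 _≐_

_≐_ : List ℕ → List ℕ → Set
v ≐ w = ∀ t → get v t ≡ get w t

AgreeOutsidePair : ℕ → List ℕ → List ℕ → Set
AgreeOutsidePair i v w = ∀ j → j ≢ i → j ≢ suc i → get v j ≡ get w j

agreeOutsidePair-< : ∀ {i v w t} → AgreeOutsidePair i v w → t < i → get v t ≡ get w t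
agreeOutsidePair-< {t = t} agree t<i = agree t (<⇒≢ t<i) (<⇒≢ (m<n⇒m<1+n t<i))

agreeOutsidePair-≥ : ∀ {i v w t} → AgreeOutsidePair i v w → suc (suc i) ≤ t → get v t ≡ get w t
agreeOutsidePair-≥ {i} {t = t} agree 2+i≤t = agree t (>⇒≢ (<-trans (n<1+n i) 2+i≤t)) (>⇒≢ 2+i≤t)

agreeOutsidePair⇒≐ : ∀ {i v w} → AgreeOutsidePair i v w →
                     get v i ≡ get w i → get v (suc i) ≡ get w (suc i) → v ≐ w
agreeOutsidePair⇒≐ {i} agree same-i same-suc-i t with t ≟ i | t ≟ suc i
... | yes refl | _        = same-i
... | no  _    | yes refl = same-suc-i
... | no  t≢i  | no t≢suc-i = agree t t≢i t≢suc-i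

module _ (v : List ℕ) (i p q : ℕ) where

  private
    n : ℕ
    n = length v ⊔ suc (suc i)

    suc-i<n : suc i < n
    suc-i<n = m≤n⊔m (length v) (suc (suc i))

  get-setPair-fst : get (setPair v i p q) i ≡ p
  get-setPair-fst = trans (get-map-applyUpTo _ id (<-trans (n<1+n i) suc-i<n))
    (if-yes (i ≟ i) refl)

  get-setPair-snd : get (setPair v i p q) (suc i) ≡ q
  get-setPair-snd = trans (get-map-applyUpTo _ id suc-i<n)
    (trans (if-no (suc i ≟ i) 1+n≢n) (if-yes (suc i ≟ suc i) refl))

  get-setPair-outside : AgreeOutsidePair i (setPair v i p q) v
  get-setPair-outside j j≢i j≢suc-i =
    trans (get-map-upTo _ n j (λ n≤j → trans skip (get-≥length v (≤-trans (m≤m⊔n _ _) n≤j)))) skip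
    where
    skip : (if ⌊ j ≟ i ⌋ then p else if ⌊ j ≟ suc i ⌋ then q else get v j) ≡ get v j
    skip = trans (if-no (j ≟ i) j≢i) (if-no (j ≟ suc i) j≢suc-i)

sTilde-setPair : ∀ α i → get α i ≡ 0 → sTilde i α ≡ setPair α i (get α (suc i)) 0
sTilde-setPair α i α-i≡0 with get α i | α-i≡0
... | .0 | refl = refl

MovedLeft : ℕ → List ℕ → List ℕ → Set
MovedLeft i w v = AgreeOutsidePair i w v × get w i ≡ get v (suc i) × get w (suc i) ≡ 0

sTilde-movedLeft : ∀ α i → get α i ≡ 0 → MovedLeft i (sTilde i α) α
sTilde-movedLeft α i α-i≡0 rewrite sTilde-setPair α i α-i≡0 =
  get-setPair-outside α i _ 0 , get-setPair-fst α i _ 0 , get-setPair-snd α i _ 0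

m≢1+n⇒m≤n⊎2+n≤m : ∀ {m n} → m ≢ suc n → m ≤ n ⊎ suc (suc n) ≤ m
m≢1+n⇒m≤n⊎2+n≤m {m} {n} m≢1+n with m ≤? n
... | yes m≤n = inj₁ m≤n
... | no  m≰n = inj₂ (≤∧≢⇒< (≰⇒> m≰n) (m≢1+n ∘ sym))

psum-cong-< : ∀ {v w} j → (∀ t → t < j → get v t ≡ get w t) → psum v j ≡ psum w j
psum-cong-< zero    _     = refl
psum-cong-< (suc j) agree =
  cong₂ _+_ (psum-cong-< j (λ t t<j → agree t (m<n⇒m<1+n t<j))) (agree j (n<1+n j))

psum-cong-≥ : ∀ {v w k j} → psum v k ≡ psum w k → (∀ t → k ≤ t → get v t ≡ get w t) →
              k ≤ j → psum v j ≡ psum w j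
psum-cong-≥ {v} {w} {k} base agree = go ∘ ≤⇒≤′
  where
  go : ∀ {j} → k ≤′ j → psum v j ≡ psum w j
  go ≤′-refl        = base
  go (≤′-step k≤′j) = cong₂ _+_ (go k≤′j) (agree _ (≤′⇒≤ k≤′j))

Rebalances : ℕ → List ℕ → List ℕ → Set
Rebalances i v w = AgreeOutsidePair i v w × (get v i + get v (suc i) ≡ get w i + get w (suc i))

psum-rebalance : ∀ {i v w j} → Rebalances i v w → j ≢ suc i → psum v j ≡ psum w j
psum-rebalance {i} {v} {w} (agree , pair-sum) j≢suc-i =
  [ below , psum-cong-≥ at-2+i (λ t → agreeOutsidePair-≥ {v = v} {w} agree) ]′ (m≢1+n⇒m≤n⊎2+n≤m j≢suc-i)
  where
  open ≡-Reasoning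

  below : ∀ {j} → j ≤ i → psum v j ≡ psum w j
  below j≤i = psum-cong-< _ λ t t<j → agreeOutsidePair-< {v = v} {w} agree (<-≤-trans t<j j≤i)

  at-2+i : psum v (suc (suc i)) ≡ psum w (suc (suc i))
  at-2+i = begin
    psum v i + get v i + get v (suc i)   ≡⟨ +-assoc (psum v i) _ _ ⟩
    psum v i + (get v i + get v (suc i)) ≡⟨ cong₂ _+_ (below ≤-refl) pair-sum ⟩
    psum w i + (get w i + get w (suc i)) ≡⟨ +-assoc (psum w i) _ _ ⟨
    psum w i + get w i + get w (suc i)   ∎

movedLeft⇒rebalances : ∀ {i w v} → get v i ≡ 0 → MovedLeft i w v → Rebalances i w v
movedLeft⇒rebalances {i} {w} {v} v-i≡0 (agree , w-i , w-suc-i≡0) = agree , (begin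
  get w i + get w (suc i) ≡⟨ cong₂ _+_ w-i w-suc-i≡0 ⟩
  get v (suc i) + 0       ≡⟨ +-comm (get v (suc i)) 0 ⟩
  0 + get v (suc i)       ≡⟨ cong (_+ get v (suc i)) v-i≡0 ⟨
  get v i + get v (suc i) ∎)
  where open ≡-Reasoning

⊴-rebalance : ∀ {i α s γ β} → Rebalances i s α → get α i ≡ 0 → s ⊴ γ → Rebalances i β γ → α ⊴ β
⊴-rebalance {i} {α} {s} {γ} {β} s≈α α-i≡0 s⊴γ β≈γ j with j ≟ suc i
... | yes refl = begin
  psum α i + get α i ≡⟨ cong (psum α i +_) α-i≡0 ⟩
  psum α i + 0       ≡⟨ +-identityʳ (psum α i) ⟩
  psum α i           ≡⟨ psum-rebalance s≈α (<⇒≢ (n<1+n i)) ⟨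
  psum s i           ≤⟨ s⊴γ i ⟩
  psum γ i           ≡⟨ psum-rebalance β≈γ (<⇒≢ (n<1+n i)) ⟨
  psum β i           ≤⟨ m≤m+n (psum β i) (get β i) ⟩
  psum β i + get β i ∎
  where open ≤-Reasoning
... | no j≢suc-i = begin
  psum α j ≡⟨ psum-rebalance s≈α j≢suc-i ⟨
  psum s j ≤⟨ s⊴γ j ⟩
  psum γ j ≡⟨ psum-rebalance β≈γ j≢suc-i ⟨
  psum β j ∎
  where open ≤-Reasoning

firstNZ-drop-zero : ∀ v k → get v k ≡ 0 → firstNZ (drop k v) ≡ firstNZ (drop (suc k) v)
firstNZ-drop-zero []      zero    _   = refl
firstNZ-drop-zero []      (suc k) _   = refl
firstNZ-drop-zero (x ∷ v) zero    x≡0 rewrite x≡0 = refl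
firstNZ-drop-zero (x ∷ v) (suc k) v-k≡0 = firstNZ-drop-zero v k v-k≡0

firstNZ-drop-suc : ∀ v k {m} → get v k ≡ suc m → firstNZ (drop k v) ≡ just (suc m)
firstNZ-drop-suc (x ∷ v) zero    x≡1+m rewrite x≡1+m = refl
firstNZ-drop-suc (x ∷ v) (suc k) v-k≡1+m = firstNZ-drop-suc v k v-k≡1+m

firstNZ-drop-step : ∀ v w k → get v k ≡ get w k →
                    firstNZ (drop (suc k) v) ≡ firstNZ (drop (suc k) w) →
                    firstNZ (drop k v) ≡ firstNZ (drop k w)
firstNZ-drop-step v w k v-k≡w-k rest with get v k in v-k
... | zero  = trans (firstNZ-drop-zero v k v-k)
                (trans rest (sym (firstNZ-drop-zero w k (sym v-k≡w-k))))
... | suc m = trans (firstNZ-drop-suc v k v-k) (sym (firstNZ-drop-suc w k (sym v-k≡w-k)))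

firstNZ-drop-agree : ∀ v w {t k} → t ≤ k → (∀ d → t ≤ d → d < k → get v d ≡ get w d) →
                     firstNZ (drop k v) ≡ firstNZ (drop k w) →
                     firstNZ (drop t v) ≡ firstNZ (drop t w)
firstNZ-drop-agree v w {t} t≤k agree = go (≤⇒≤′ t≤k) agree
  where
  go : ∀ {k} → t ≤′ k → (∀ d → t ≤ d → d < k → get v d ≡ get w d) →
       firstNZ (drop k v) ≡ firstNZ (drop k w) → firstNZ (drop t v) ≡ firstNZ (drop t w)
  go ≤′-refl           _     same = same
  go (≤′-step {k} t≤′k) agree same =
    go t≤′k (λ d t≤d d<k → agree d t≤d (m<n⇒m<1+n d<k))
      (firstNZ-drop-step v w k (agree k (≤′⇒≤ t≤′k) (n<1+n k)) same)

firstNZ-drop-cong : ∀ v w k → (∀ d → k ≤ d → get v d ≡ get w d) →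
                    firstNZ (drop k v) ≡ firstNZ (drop k w)
firstNZ-drop-cong v w k agree =
  firstNZ-drop-agree v w (m≤m⊔n k _) (λ d k≤d _ → agree d k≤d)
    (cong firstNZ (trans (drop-all K v len-v≤K) (sym (drop-all K w len-w≤K))))
  where
  K : ℕ
  K = k ⊔ (length v ⊔ length w)
  len-v≤K : length v ≤ K
  len-v≤K = ≤-trans (m≤m⊔n _ _) (m≤n⊔m k _)
  len-w≤K : length w ≤ K
  len-w≤K = ≤-trans (m≤n⊔m _ _) (m≤n⊔m k _)

qshiftAt-≥length : ∀ v {t} → length v ≤ t → qshiftAt v t ≡ 0
qshiftAt-≥length []  {zero}  _      = refl
qshiftAt-≥length v   {suc j} len≤t rewrite get-≥length v len≤t with get v j
... | zero  = refl
... | suc _ rewrite drop-all (suc j) v len≤t = refl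

get-qshift : ∀ v t → get (qshift v) t ≡ qshiftAt v t
get-qshift v t = get-map-upTo (qshiftAt v) (length v) t (qshiftAt-≥length v)

psum-qshift-suc : ∀ v t → psum (qshift v) (suc t) ≡ psum (qshift v) t + qshiftAt v t
psum-qshift-suc v t = cong (psum (qshift v) t +_) (get-qshift v t)

qshiftAt-cong : ∀ v w t → get v t ≡ get w t → get v (pred t) ≡ get w (pred t) →
                firstNZ (drop t v) ≡ firstNZ (drop t w) → qshiftAt v t ≡ qshiftAt w t
qshiftAt-cong v w zero    same-t _ same-next rewrite same-t with get w 0
... | zero  = cong (maybe pred 0) same-next
... | suc _ = refl
qshiftAt-cong v w (suc j) same-t same-j same-next rewrite same-t | same-j
  with get w (suc j) | get w j
... | suc _ | suc _ = refl
... | suc _ | zero  = refl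
... | zero  | suc _ = cong (maybe pred 0) same-next
... | zero  | zero  = refl

qshiftAt-raise : ∀ v w t {a} → get v t ≡ 0 → get w t ≡ suc a →
                 (∀ d → d < t → get w d ≡ get v d) → firstNZ (drop t v) ≡ just (suc a) →
                 qshiftAt w t ≡ suc (qshiftAt v t)
qshiftAt-raise v w zero    v-0≡0 w-0 _ next rewrite v-0≡0 | w-0 | next = refl
qshiftAt-raise v w (suc j) v-t≡0 w-t below next rewrite v-t≡0 | w-t | below j (n<1+n j)
  with get v j
... | zero  = refl
... | suc _ rewrite next = refl

psum-qshift-cong : ∀ {v w} → v ≐ w → ∀ j → psum (qshift v) j ≡ psum (qshift w) j
psum-qshift-cong {v} {w} v≐w j = psum-cong-< j λ t _ →
  trans (get-qshift v t)
    (trans (qshiftAt-cong v w t (v≐w t) (v≐w (pred t)) (firstNZ-drop-cong v w t (λ d _ → v≐w d)))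
           (sym (get-qshift w t)))

record BoundedExcessAt (i : ℕ) (P Q : ℕ → ℕ) : Set where
  field
    agree-off : ∀ j → j ≢ suc i → j ≢ suc (suc i) → P j ≡ Q j
    excess≤1  : P (suc i) ≤ suc (Q (suc i))
    absorbed  : P (suc i) ≤ Q (suc (suc i))

boundedExcess-≐ : ∀ {i v w} → v ≐ w → BoundedExcessAt i (psum (qshift v)) (psum (qshift w))
boundedExcess-≐ {i} {v} {w} v≐w = record
  { agree-off = λ j _ _ → psum-qshift-cong v≐w j
  ; excess≤1  = m≤n⇒m≤1+n (≤-reflexive (psum-qshift-cong v≐w (suc i)))
  ; absorbed  = ≤-trans (≤-reflexive (psum-qshift-cong v≐w (suc i))) (m≤m+n _ _)
  }

module MoveLeft {v w : List ℕ} {i a : ℕ} (agree : AgreeOutsidePair i w v)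
                (v-i≡0 : get v i ≡ 0) (v-suc-i : get v (suc i) ≡ suc a)
                (w-i : get w i ≡ suc a) (w-suc-i≡0 : get w (suc i) ≡ 0) where

  open ≡-Reasoning

  private
    P Q : ℕ → ℕ
    P = psum (qshift w)
    Q = psum (qshift v)

    below : ∀ {t} → t < i → get w t ≡ get v t
    below = agreeOutsidePair-< {v = w} {v} agree

    beyond : ∀ {t} → suc (suc i) ≤ t → get w t ≡ get v t
    beyond = agreeOutsidePair-≥ {v = w} {v} agree

  firstNZ-drop-≤ : ∀ {t} → t ≤ i → firstNZ (drop t w) ≡ firstNZ (drop t v)
  firstNZ-drop-≤ t≤i = firstNZ-drop-agree w v t≤i (λ _ _ → below)
    (trans (firstNZ-drop-suc w i w-i)
           (sym (trans (firstNZ-drop-zero v i v-i≡0) (firstNZ-drop-suc v (suc i) v-suc-i))))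

  firstNZ-drop-≥ : ∀ {t} → suc (suc i) ≤ t → firstNZ (drop t w) ≡ firstNZ (drop t v)
  firstNZ-drop-≥ {t} 2+i≤t = firstNZ-drop-cong w v t (λ d t≤d → beyond (≤-trans 2+i≤t t≤d))

  qshiftAt-< : ∀ {t} → t < i → qshiftAt w t ≡ qshiftAt v t
  qshiftAt-< {t} t<i = qshiftAt-cong w v t (below t<i) (below (≤-<-trans pred[n]≤n t<i))
                         (firstNZ-drop-≤ (<⇒≤ t<i))

  qshiftAt-≥ : ∀ {t} → suc (suc (suc i)) ≤ t → qshiftAt w t ≡ qshiftAt v t
  qshiftAt-≥ {suc t} (s≤s 2+i≤t) =
    qshiftAt-cong w v (suc t) (beyond (m≤n⇒m≤1+n 2+i≤t)) (beyond 2+i≤t)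
      (firstNZ-drop-≥ (m≤n⇒m≤1+n 2+i≤t))

  qshiftAt-i : qshiftAt w i ≡ suc (qshiftAt v i)
  qshiftAt-i = qshiftAt-raise v w i v-i≡0 w-i (λ _ → below)
    (trans (firstNZ-drop-zero v i v-i≡0) (firstNZ-drop-suc v (suc i) v-suc-i))

  qshiftAt-suc-i : qshiftAt v (suc i) ≡ 1
  qshiftAt-suc-i rewrite v-suc-i | v-i≡0 = refl

  qshiftAt-2+i : qshiftAt w (suc i) + qshiftAt w (suc (suc i)) ≡ qshiftAt v (suc (suc i))
  qshiftAt-2+i rewrite w-suc-i≡0 | w-i | beyond {suc (suc i)} ≤-refl
                     | firstNZ-drop-zero w (suc i) w-suc-i≡0 | firstNZ-drop-≥ {suc (suc i)} ≤-refl
                     | v-suc-i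
    with get v (suc (suc i)) in v-2+i
  ... | zero   = +-identityʳ _
  ... | suc c rewrite firstNZ-drop-suc v (suc (suc i)) v-2+i = +-comm c 1

  psum-≤ : ∀ {j} → j ≤ i → P j ≡ Q j
  psum-≤ {j} j≤i = psum-cong-< j λ t t<j → begin
    get (qshift w) t ≡⟨ get-qshift w t ⟩
    qshiftAt w t     ≡⟨ qshiftAt-< (<-≤-trans t<j j≤i) ⟩
    qshiftAt v t     ≡⟨ get-qshift v t ⟨
    get (qshift v) t ∎

  psum-suc-i : P (suc i) ≡ suc (Q (suc i))
  psum-suc-i = begin
    P i + get (qshift w) i    ≡⟨ psum-qshift-suc w i ⟩
    P i + qshiftAt w i        ≡⟨ cong₂ _+_ (psum-≤ ≤-refl) qshiftAt-i ⟩
    Q i + suc (qshiftAt v i)  ≡⟨ +-suc (Q i) _ ⟩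
    suc (Q i + qshiftAt v i)  ≡⟨ cong suc (psum-qshift-suc v i) ⟨
    suc (Q (suc i))           ∎

  psum-2+i : Q (suc (suc i)) ≡ suc (Q (suc i))
  psum-2+i = begin
    Q (suc (suc i))                ≡⟨ psum-qshift-suc v (suc i) ⟩
    Q (suc i) + qshiftAt v (suc i) ≡⟨ cong (Q (suc i) +_) qshiftAt-suc-i ⟩
    Q (suc i) + 1                  ≡⟨ +-comm (Q (suc i)) 1 ⟩
    suc (Q (suc i))                ∎

  psum-3+i : P (suc (suc (suc i))) ≡ Q (suc (suc (suc i)))
  psum-3+i = begin
    P (suc (suc (suc i)))
      ≡⟨ cong₂ _+_ (psum-qshift-suc w (suc i)) (get-qshift w (suc (suc i))) ⟩
    P (suc i) + qshiftAt w (suc i) + qshiftAt w (suc (suc i))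
      ≡⟨ +-assoc (P (suc i)) _ _ ⟩
    P (suc i) + (qshiftAt w (suc i) + qshiftAt w (suc (suc i)))
      ≡⟨ cong₂ _+_ psum-suc-i qshiftAt-2+i ⟩
    suc (Q (suc i)) + qshiftAt v (suc (suc i))
      ≡⟨ cong (_+ qshiftAt v (suc (suc i))) psum-2+i ⟨
    Q (suc (suc i)) + qshiftAt v (suc (suc i))
      ≡⟨ psum-qshift-suc v (suc (suc i)) ⟨
    Q (suc (suc (suc i)))
      ∎

  boundedExcess : BoundedExcessAt i P Q
  boundedExcess = record
    { agree-off = λ j j≢suc-i j≢2+i →
        [ psum-≤ , (λ 2+i≤j → psum-≥ (≤∧≢⇒< 2+i≤j (j≢2+i ∘ sym))) ]′ (m≢1+n⇒m≤n⊎2+n≤m j≢suc-i)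
    ; excess≤1  = ≤-reflexive psum-suc-i
    ; absorbed  = ≤-reflexive (trans psum-suc-i (sym psum-2+i))
    }
    where
    psum-≥ : ∀ {j} → suc (suc (suc i)) ≤ j → P j ≡ Q j
    psum-≥ = psum-cong-≥ psum-3+i λ t 3+i≤t →
      trans (get-qshift w t) (trans (qshiftAt-≥ 3+i≤t) (sym (get-qshift v t)))

boundedExcess-moveLeft : ∀ {i v w} → MovedLeft i w v → get v i ≡ 0 →
                         BoundedExcessAt i (psum (qshift w)) (psum (qshift v))
boundedExcess-moveLeft {i} {v} {w} (agree , w-i , w-suc-i≡0) v-i≡0 with get v (suc i) in v-suc-i
... | zero  = boundedExcess-≐ (agreeOutsidePair⇒≐ {v = w} {v} agree (trans w-i (sym v-i≡0))
                                                         (trans w-suc-i≡0 (sym v-suc-i)))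
... | suc _ = MoveLeft.boundedExcess agree v-i≡0 v-suc-i w-i w-suc-i≡0

⊴-absorbExcess : ∀ {i β γ P Q} → Rebalances i β γ → get β i < get γ i → get γ (suc i) ≡ 0 →
                 (∀ j → psum γ j ≤ P j) → BoundedExcessAt i P Q → ∀ j → psum β j ≤ Q j
⊴-absorbExcess {i} {β} {γ} {P} {Q} β≈γ β-i<γ-i γ-suc-i≡0 γ≤P excess j
  with j ≟ suc i | j ≟ suc (suc i)
... | yes refl | _ = ≤-pred (begin-strict
  psum β i + get β i   ≡⟨ cong (_+ get β i) (psum-rebalance β≈γ (<⇒≢ (n<1+n i))) ⟩
  psum γ i + get β i   <⟨ +-monoʳ-< (psum γ i) β-i<γ-i ⟩
  psum γ (suc i)       ≤⟨ γ≤P (suc i) ⟩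
  P (suc i)            ≤⟨ excess≤1 ⟩
  suc (Q (suc i))      ∎)
  where open ≤-Reasoning; open BoundedExcessAt excess
... | no _ | yes refl = begin
  psum β (suc (suc i))           ≡⟨ psum-rebalance β≈γ 1+n≢n ⟩
  psum γ (suc i) + get γ (suc i) ≡⟨ cong (psum γ (suc i) +_) γ-suc-i≡0 ⟩
  psum γ (suc i) + 0             ≡⟨ +-identityʳ _ ⟩
  psum γ (suc i)                 ≤⟨ γ≤P (suc i) ⟩
  P (suc i)                      ≤⟨ absorbed ⟩
  Q (suc (suc i))                ∎
  where open ≤-Reasoning; open BoundedExcessAt excess
... | no j≢suc-i | no j≢2+i = begin
  psum β j ≡⟨ psum-rebalance β≈γ j≢suc-i ⟩
  psum γ j ≤⟨ γ≤P j ⟩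
  P j      ≡⟨ agree-off j j≢suc-i j≢2+i ⟩
  Q j      ∎
  where open ≤-Reasoning; open BoundedExcessAt excess

thetaTilde-vanishes : ∀ i γ → 0 < get γ i → 0 < get γ (suc i) → IsZeroPoly (thetaTilde i γ)
thetaTilde-vanishes i γ γ-i>0 γ-suc-i>0 with get γ i | get γ (suc i)
... | suc _ | suc _ = λ _ → refl

thetaTilde-nonzero⇒next≡0 : ∀ i γ → ¬ IsZeroPoly (thetaTilde i γ) → 0 < get γ i → get γ (suc i) ≡ 0
thetaTilde-nonzero⇒next≡0 i γ θ≢0 γ-i>0 with get γ (suc i) ≟ 0
... | yes γ-suc-i≡0 = γ-suc-i≡0
... | no  γ-suc-i≢0 = contradiction (thetaTilde-vanishes i γ γ-i>0 (n≢0⇒n>0 γ-suc-i≢0)) θ≢0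

mainTheorem2 : (α : List ℕ) (i : ℕ) → i < length α → get α i ≡ 0 →
    (γ : List ℕ) → sTilde i α ⊴ γ → γ ⊴ qshift (sTilde i α) →
    ¬ IsZeroPoly (thetaTilde i γ) →
    (β : List ℕ) → (∀ j → j ≢ i → j ≢ suc i → get β j ≡ get γ j) →
    suc (get β i) ≤ get γ i → get β (suc i) ≡ get γ i ∸ get β i →
    (α ⊴ β) × (β ⊴ qshift α)
-- The bound i < length α is not needed: get reads entries past the end as 0.
mainTheorem2 α i _ α-i≡0 γ s⊴γ γ⊴qs θ≢0 β β-agree β-i<γ-i β-suc-i =
    ⊴-rebalance s≈α α-i≡0 s⊴γ β≈γ
  , ⊴-absorbExcess β≈γ β-i<γ-i γ-suc-i≡0 γ⊴qs
      (boundedExcess-moveLeft s-movedLeft α-i≡0)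
  where
  open ≡-Reasoning

  s-movedLeft : MovedLeft i (sTilde i α) α
  s-movedLeft = sTilde-movedLeft α i α-i≡0

  s≈α : Rebalances i (sTilde i α) α
  s≈α = movedLeft⇒rebalances {w = sTilde i α} {α} α-i≡0 s-movedLeft

  γ-suc-i≡0 : get γ (suc i) ≡ 0
  γ-suc-i≡0 = thetaTilde-nonzero⇒next≡0 i γ θ≢0 (≤-<-trans z≤n β-i<γ-i)

  β≈γ : Rebalances i β γ
  β≈γ = β-agree , (begin
    get β i + get β (suc i)       ≡⟨ cong (get β i +_) β-suc-i ⟩
    get β i + (get γ i ∸ get β i) ≡⟨ m+[n∸m]≡n (<⇒≤ β-i<γ-i) ⟩
    get γ i                       ≡⟨ +-identityʳ (get γ i) ⟨
    get γ i + 0                   ≡⟨ cong (get γ i +_) γ-suc-i≡0 ⟨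
    get γ i + get γ (suc i)       ∎)
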